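{- Let $\tau=213$. For all $k\ge 2$, \[ F_\tau(x,y;k)=\frac{1}{1-x-x\sum_{i=0}^{k-2}\prod_{j=0}^{i}\bigl(1-jx^2(1-y)\bigr)}. \]
   Context: $[k]^n$ is the set of words of length $n$ over $\{1,\dots,k\}$. An occurrence of the subword pattern $213$ in $\sigma=\sigma_1\cdots\sigma_n$ is an index $i$ with $\sigma_{i+1}<\sigma_i<\sigma_{i+2}$. $\sigma(213)$ is the number of occurrences, and $F_{213}(x,y;k)=\sum_{n\ge0}\sum_{\sigma\in[k]^n}x^ny^{\sigma(213)}$. -}

module Defs where

open import Data.Nat as ℕ using (ℕ; zero; suc; _∸_)
open import Data.Integer as ℤ using (ℤ; +_)
open import Data.Fin using (Fin; _<?_)
open import Data.List using (List; []; _∷_; [_]; map; concatMap; allFin; filter; length)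
open import Relation.Nullary using (does)
open import Data.Bool using (Bool; true; false; _∧_; if_then_else_)

-- Words over a k-letter alphabet (letters Fin k, ordered as 0 < … < k-1,
-- i.e. the letter i stands for i+1 ∈ {1,…,k}).

words : (k n : ℕ) → List (List (Fin k))
words k zero    = [ [] ]
words k (suc n) = concatMap (λ w → map (λ a → a ∷ w) (allFin k)) (words k n)

occ213 : ∀ {k} → List (Fin k) → ℕ
occ213 (a ∷ l@(b ∷ c ∷ rest)) =
  (if does (b <? a) ∧ does (a <? c) then 1 else 0) ℕ.+ occ213 l
occ213 _ = 0

-- Formal power series in x, y with integer coefficients:
-- s n m is the coefficient of x^n y^m.

Series : Set
Series = ℕ → ℕ → ℤ

sumTo : ℕ → (ℕ → ℤ) → ℤ
sumTo zero    f = f 0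
sumTo (suc n) f = sumTo n f ℤ.+ f (suc n)

infixl 6 _⊕_ _⊖_
infixl 7 _⊛_

_⊕_ : Series → Series → Series
(f ⊕ g) n m = f n m ℤ.+ g n m

_⊖_ : Series → Series → Series
(f ⊖ g) n m = f n m ℤ.- g n m

_⊛_ : Series → Series → Series
(f ⊛ g) n m = sumTo n λ i → sumTo m λ j → f i j ℤ.* g (n ∸ i) (m ∸ j)

mono : ℤ → ℕ → ℕ → Series
mono c a b n m with n ℕ.≟ a | m ℕ.≟ b
... | Relation.Nullary.yes _ | Relation.Nullary.yes _ = c
... | _ | _ = + 0

𝟘 𝟙 X Y : Series
𝟘 = mono (+ 0) 0 0
𝟙 = mono (+ 1) 0 0
X = mono (+ 1) 1 0
Y = mono (+ 1) 0 1

const : ℕ → Series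
const c = mono (+ c) 0 0

sumS : ℕ → (ℕ → Series) → Series
sumS zero    s = s 0
sumS (suc n) s = sumS n s ⊕ s (suc n)

prodS : ℕ → (ℕ → Series) → Series
prodS zero    s = s 0
prodS (suc n) s = prodS n s ⊛ s (suc n)

F213 : ℕ → Series
F213 k n m = + length (filter (λ w → occ213 w ℕ.≟ m) (words k n))

Den : ℕ → Series
Den k = 𝟙 ⊖ X ⊖ X ⊛ sumS (k ∸ 2) (λ i →
          prodS i (λ j → 𝟙 ⊖ const j ⊛ X ⊛ X ⊛ (𝟙 ⊖ Y)))

{-# OPTIONS --safe #-}
-- Let G_b = ∑_w x^|w| y^occ(b w) collect the words starting with the letter b, the
-- leading b not counted by x.  Splitting off the first letter gives F = 1 + x ∑_b G_b.
-- The words b a c r and a c r have the same number of occurrences unless a < b < c, in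
-- which case b a c r has one more and a c r has as many as c r; as exactly b letters
-- lie below b (letters are counted from 0), summing over a, c and r gives
-- G_b + b x²(1-y) ∑_{c>b} G_c = F.  Solving this triangular system from the largest
-- letter down gives ∑_b G_b = F Φ with Φ = 1 + ∑_{i=0}^{k-2} ∏_{j=0}^{i} (1 - j x²(1-y)),
-- hence F (1 - x Φ) = 1.  Power series are coefficient sequences, and ℤ⟦y⟧⟦x⟧ is the
-- ring of series over ℤ⟦y⟧.
module Submission where

open import Defs
open import Data.Nat using (ℕ; _≤_; s≤s; z≤n)
open import Relation.Binary.PropositionalEquality using (_≡_)

open import Algebra using (CommutativeRing)
open import Data.Bool using (Bool; true; false; if_then_else_; _∧_)
open import Data.Fin using (Fin; zero; suc; toℕ; _<?_)
import Data.Fin as Fin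
import Data.Fin.Properties as Fin
open import Data.Integer using (+_)
import Data.Integer as ℤ
import Data.Integer.Properties as ℤ
open import Data.List using (List; []; _∷_; _++_; map; concatMap; tabulate; allFin; filter; length)
open import Data.Nat using (zero; suc; _∸_)
import Data.Nat as ℕ
open import Data.Product using (_,_)
open import Function using (_∘_; id)
open import Level using (0ℓ)
open import Relation.Nullary using (Dec; does; yes; no; ¬_)
open import Relation.Nullary.Decidable using (dec-false)
import Relation.Binary.PropositionalEquality as ≡

module Sums {c ℓ} (R : CommutativeRing c ℓ) where
  open CommutativeRing R hiding (zero)
  open import Algebra.Properties.Semiring.Sum semiring
  open import Algebra.Properties.Semiring.Mult semiring using (_×_)
  open import Algebra.Properties.CommutativeSemigroup +-commutativeSemigroup using (interchange)

  private variable A B : Set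

  [_] : Bool → Carrier
  [ true ]  = 1#
  [ false ] = 0#

  ∑[a<b]≈b : ∀ {k} (b : Fin k) → ∑[ a < k ] [ does (a <? b) ] ≈ toℕ b × 1#
  ∑[a<b]≈b {suc k} zero    = trans (+-identityˡ _) (sum-replicate-zero k)
  ∑[a<b]≈b {suc k} (suc b) = +-congˡ (∑[a<b]≈b b)

  ∑ˡ : List A → (A → Carrier) → Carrier
  ∑ˡ []       φ = 0#
  ∑ˡ (a ∷ as) φ = φ a + ∑ˡ as φ

  ∑ˡ-cong : ∀ (as : List A) {φ ψ} → (∀ a → φ a ≈ ψ a) → ∑ˡ as φ ≈ ∑ˡ as ψ
  ∑ˡ-cong []       φ≈ψ = refl
  ∑ˡ-cong (a ∷ as) φ≈ψ = +-cong (φ≈ψ a) (∑ˡ-cong as φ≈ψ)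

  ∑ˡ-++ : ∀ (as bs : List A) φ → ∑ˡ (as ++ bs) φ ≈ ∑ˡ as φ + ∑ˡ bs φ
  ∑ˡ-++ []       bs φ = sym (+-identityˡ _)
  ∑ˡ-++ (a ∷ as) bs φ = trans (+-congˡ (∑ˡ-++ as bs φ)) (sym (+-assoc _ _ _))

  ∑ˡ-map : ∀ (f : A → B) as φ → ∑ˡ (map f as) φ ≈ ∑ˡ as (φ ∘ f)
  ∑ˡ-map f []       φ = refl
  ∑ˡ-map f (a ∷ as) φ = +-congˡ (∑ˡ-map f as φ)

  ∑ˡ-concatMap : ∀ (f : A → List B) as φ →
                 ∑ˡ (concatMap f as) φ ≈ ∑ˡ as (λ a → ∑ˡ (f a) φ)
  ∑ˡ-concatMap f []       φ = refl
  ∑ˡ-concatMap f (a ∷ as) φ =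
    trans (∑ˡ-++ (f a) (concatMap f as) φ) (+-congˡ (∑ˡ-concatMap f as φ))

  ∑ˡ-tabulate : ∀ {k} (f : Fin k → A) φ → ∑ˡ (tabulate f) φ ≈ ∑[ i < k ] φ (f i)
  ∑ˡ-tabulate {k = zero}  f φ = refl
  ∑ˡ-tabulate {k = suc k} f φ = +-congˡ (∑ˡ-tabulate (f ∘ suc) φ)

  ∑ˡ-distrib-+ : ∀ (as : List A) φ ψ → ∑ˡ as (λ a → φ a + ψ a) ≈ ∑ˡ as φ + ∑ˡ as ψ
  ∑ˡ-distrib-+ []       φ ψ = sym (+-identityˡ _)
  ∑ˡ-distrib-+ (a ∷ as) φ ψ = trans (+-congˡ (∑ˡ-distrib-+ as φ ψ)) (interchange _ _ _ _)

  *-distribˡ-∑ˡ : ∀ x (as : List A) φ → x * ∑ˡ as φ ≈ ∑ˡ as (λ a → x * φ a)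
  *-distribˡ-∑ˡ x []       φ = zeroʳ x
  *-distribˡ-∑ˡ x (a ∷ as) φ = trans (distribˡ x _ _) (+-congˡ (*-distribˡ-∑ˡ x as φ))

  ∑ˡ-comm-∑ : ∀ {k} (as : List A) (φ : A → Fin k → Carrier) →
              ∑ˡ as (λ a → ∑[ i < k ] φ a i) ≈ ∑[ i < k ] ∑ˡ as (λ a → φ a i)
  ∑ˡ-comm-∑ {k = k} []       φ = sym (sum-replicate-zero k)
  ∑ˡ-comm-∑     (a ∷ as) φ = trans (+-congˡ (∑ˡ-comm-∑ as φ)) (sym (∑-distrib-+ (φ a) _))

  sum≤ : ℕ → (ℕ → Carrier) → Carrier
  sum≤ zero    f = f 0
  sum≤ (suc n) f = sum≤ n f + f (suc n)

  prod≤ : ℕ → (ℕ → Carrier) → Carrier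
  prod≤ zero    f = f 0
  prod≤ (suc n) f = prod≤ n f * f (suc n)

  sum≤-cong : ∀ n {f g} → (∀ i → f i ≈ g i) → sum≤ n f ≈ sum≤ n g
  sum≤-cong zero    f≈g = f≈g 0
  sum≤-cong (suc n) f≈g = +-cong (sum≤-cong n f≈g) (f≈g (suc n))

  prod≤-cong : ∀ n {f g} → (∀ i → f i ≈ g i) → prod≤ n f ≈ prod≤ n g
  prod≤-cong zero    f≈g = f≈g 0
  prod≤-cong (suc n) f≈g = *-cong (prod≤-cong n f≈g) (f≈g (suc n))

  sum≤-suc : ∀ n f → sum≤ (suc n) f ≈ f 0 + sum≤ n (f ∘ suc)
  sum≤-suc zero    f = refl
  sum≤-suc (suc n) f = trans (+-congʳ (sum≤-suc n f)) (+-assoc _ _ _)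

  prod≤-suc : ∀ n f → prod≤ (suc n) f ≈ f 0 * prod≤ n (f ∘ suc)
  prod≤-suc zero    f = refl
  prod≤-suc (suc n) f = trans (*-congʳ (prod≤-suc n f)) (*-assoc _ _ _)

  *-distribˡ-sum≤ : ∀ x n f → x * sum≤ n f ≈ sum≤ n (λ i → x * f i)
  *-distribˡ-sum≤ x zero    f = refl
  *-distribˡ-sum≤ x (suc n) f = trans (distribˡ x _ _) (+-congʳ (*-distribˡ-sum≤ x n f))

module TriangularSystem {c ℓ} (R : CommutativeRing c ℓ) where
  open CommutativeRing R hiding (zero)
  open Sums R
  open import Algebra.Properties.Semiring.Sum semiring
  open import Algebra.Properties.Ring ring using ([y-z]x≈yx-zx; x[y-z]≈xy-xz)
  open import Algebra.Properties.CommutativeSemigroup +-commutativeSemigroup using ()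
    renaming (x∙yz≈y∙xz to x+yz≈y+xz)
  open import Algebra.Properties.CommutativeSemigroup *-commutativeSemigroup using ()
    renaming (x∙yz≈y∙xz to x*yz≈y*xz)
  open import Relation.Binary.Reasoning.Setoid setoid

  x*z+[1-x]*z≈z : ∀ x z → x * z + (1# - x) * z ≈ z
  x*z+[1-x]*z≈z x z = begin
    x * z + (1# - x) * z      ≈⟨ +-congˡ ([y-z]x≈yx-zx z 1# x) ⟩
    x * z + (1# * z - x * z)  ≈⟨ +-congˡ (+-congʳ (*-identityˡ z)) ⟩
    x * z + (z - x * z)       ≈⟨ x+yz≈y+xz (x * z) z (- (x * z)) ⟩
    z + (x * z - x * z)       ≈⟨ +-congˡ (-‿inverseʳ (x * z)) ⟩
    z + 0#                    ≈⟨ +-identityʳ z ⟩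
    z                         ∎

  prefixProductSum : ℕ → (ℕ → Carrier) → Carrier
  prefixProductSum zero    e = 0#
  prefixProductSum (suc k) e = 1# + (1# - e 0) * prefixProductSum k (e ∘ suc)

  prefixProductSum-closed : ∀ k e →
    prefixProductSum (suc (suc k)) e ≈ 1# + sum≤ k (λ i → prod≤ i (λ j → 1# - e j))
  prefixProductSum-closed zero    e =
    +-congˡ (trans (*-congˡ (trans (+-congˡ (zeroʳ _)) (+-identityʳ 1#))) (*-identityʳ _))
  prefixProductSum-closed (suc k) e = +-congˡ (begin
    (1# - e 0) * prefixProductSum (suc (suc k)) (e ∘ suc)
      ≈⟨ *-congˡ (prefixProductSum-closed k (e ∘ suc)) ⟩
    (1# - e 0) * (1# + sum≤ k (λ i → prod≤ i (λ j → 1# - e (suc j))))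
      ≈⟨ distribˡ _ 1# _ ⟩
    (1# - e 0) * 1# + (1# - e 0) * sum≤ k (λ i → prod≤ i (λ j → 1# - e (suc j)))
      ≈⟨ +-cong (*-identityʳ _) (*-distribˡ-sum≤ _ k _) ⟩
    (1# - e 0) + sum≤ k (λ i → (1# - e 0) * prod≤ i (λ j → 1# - e (suc j)))
      ≈⟨ +-congˡ (sum≤-cong k (λ i → sym (prod≤-suc i (λ j → 1# - e j)))) ⟩
    (1# - e 0) + sum≤ k (λ i → prod≤ (suc i) (λ j → 1# - e j))
      ≈⟨ sym (sum≤-suc k (λ i → prod≤ i (λ j → 1# - e j))) ⟩
    sum≤ (suc k) (λ i → prod≤ i (λ j → 1# - e j)) ∎)

  -- The equation of the letter 0 involves only the sum T over the other letters, and
  -- those satisfy the same system with e shifted.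
  ∑-triangular-solution : ∀ {k} F (e : ℕ → Carrier) (g : Fin k → Carrier) →
    (∀ b → g b + e (toℕ b) * ∑[ c < k ] ([ does (b <? c) ] * g c) ≈ F) →
    ∑[ c < k ] g c ≈ F * prefixProductSum k e
  ∑-triangular-solution {zero}  F e g eqs = sym (zeroʳ F)
  ∑-triangular-solution {suc k} F e g eqs = begin
    g zero + T                              ≈⟨ +-congˡ (sym (x*z+[1-x]*z≈z (e 0) T)) ⟩
    g zero + (e 0 * T + (1# - e 0) * T)     ≈⟨ sym (+-assoc _ _ _) ⟩
    (g zero + e 0 * T) + (1# - e 0) * T     ≈⟨ +-cong eq₀ (*-congˡ T≈FΦ) ⟩
    F + (1# - e 0) * (F * Φ)                ≈⟨ +-cong (sym (*-identityʳ F)) (x*yz≈y*xz _ F Φ) ⟩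
    F * 1# + F * ((1# - e 0) * Φ)           ≈⟨ sym (distribˡ F 1# _) ⟩
    F * (1# + (1# - e 0) * Φ)               ∎
    where
    T = ∑[ c < k ] g (suc c)
    Φ = prefixProductSum k (e ∘ suc)
    0*x+y≈y : ∀ x y → 0# * x + y ≈ y
    0*x+y≈y x y = trans (+-congʳ (zeroˡ x)) (+-identityˡ y)
    eq₀ : g zero + e 0 * T ≈ F
    eq₀ = trans (+-congˡ (*-congˡ (sym (trans (0*x+y≈y _ _)
            (sum-cong-≋ (λ c → *-identityˡ (g (suc c)))))))) (eqs zero)
    T≈FΦ : T ≈ F * Φ
    T≈FΦ = ∑-triangular-solution F (e ∘ suc) (g ∘ suc)
             (λ b → trans (+-congˡ (*-congˡ (sym (0*x+y≈y _ _)))) (eqs (suc b)))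

  fixpoint⇒inverse : ∀ {F x Φ} → F ≈ 1# + x * (F * Φ) → F * (1# - x * Φ) ≈ 1#
  fixpoint⇒inverse {F} {x} {Φ} F≈ = begin
    F * (1# - x * Φ)                 ≈⟨ x[y-z]≈xy-xz F 1# (x * Φ) ⟩
    F * 1# - F * (x * Φ)             ≈⟨ +-cong (*-identityʳ F) (-‿cong (x*yz≈y*xz F x Φ)) ⟩
    F - x * (F * Φ)                  ≈⟨ +-congʳ F≈ ⟩
    1# + x * (F * Φ) - x * (F * Φ)   ≈⟨ +-assoc _ _ _ ⟩
    1# + (x * (F * Φ) - x * (F * Φ)) ≈⟨ +-congˡ (-‿inverseʳ _) ⟩
    1# + 0#                          ≈⟨ +-identityʳ 1# ⟩
    1#                               ∎

module FormalPowerSeries {c ℓ} (R : CommutativeRing c ℓ) where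
  open CommutativeRing R hiding (zero)
  open Sums R
  open import Algebra.Properties.Semiring.Sum semiring using (sum)
  open import Algebra.Properties.CommutativeSemigroup +-commutativeSemigroup
    using (interchange; x∙yz≈y∙xz)

  FPS : Set c
  FPS = ℕ → Carrier

  infix  4 _≋_
  infixl 6 _⊞_
  infixl 7 _⊠_ _·_

  _≋_ : FPS → FPS → Set ℓ
  f ≋ g = ∀ n → f n ≈ g n

  _⊞_ : FPS → FPS → FPS
  (f ⊞ g) n = f n + g n

  ⊟_ : FPS → FPS
  (⊟ f) n = - f n

  𝟎 : FPS
  𝟎 _ = 0#

  C : Carrier → FPS
  C a zero    = a
  C a (suc n) = 0#

  _·_ : Carrier → FPS → FPS
  (a · f) n = a * f n

  -- f g = f₀ g + x (f′ g), where f = f₀ + x f′; this recursion replaces the Cauchy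
  -- sum and makes every ring law a plain induction on the degree.
  _⊠_ : FPS → FPS → FPS
  (f ⊠ g) zero    = f 0 * g 0
  (f ⊠ g) (suc n) = f 0 * g (suc n) + (f ∘ suc ⊠ g) n

  ⊠-cong : ∀ {f f′ g g′} → f ≋ f′ → g ≋ g′ → f ⊠ g ≋ f′ ⊠ g′
  ⊠-cong f≋f′ g≋g′ zero    = *-cong (f≋f′ 0) (g≋g′ 0)
  ⊠-cong f≋f′ g≋g′ (suc n) =
    +-cong (*-cong (f≋f′ 0) (g≋g′ (suc n))) (⊠-cong (f≋f′ ∘ suc) g≋g′ n)

  ⊠-zeroˡ : ∀ g → 𝟎 ⊠ g ≋ 𝟎
  ⊠-zeroˡ g zero    = zeroˡ (g 0)
  ⊠-zeroˡ g (suc n) = trans (+-cong (zeroˡ _) (⊠-zeroˡ g n)) (+-identityˡ 0#)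

  C-⊠ : ∀ a g → C a ⊠ g ≋ a · g
  C-⊠ a g zero    = refl
  C-⊠ a g (suc n) = trans (+-congˡ (⊠-zeroˡ g n)) (+-identityʳ _)

  ⊠-identityˡ : ∀ f → C 1# ⊠ f ≋ f
  ⊠-identityˡ f n = trans (C-⊠ 1# f n) (*-identityˡ (f n))

  ·-⊠ : ∀ a f g → a · f ⊠ g ≋ a · (f ⊠ g)
  ·-⊠ a f g zero    = *-assoc a (f 0) (g 0)
  ·-⊠ a f g (suc n) = trans (+-cong (*-assoc a (f 0) _) (·-⊠ a (f ∘ suc) g n)) (sym (distribˡ a _ _))

  ⊠-distribʳ : ∀ h f g → (f ⊞ g) ⊠ h ≋ f ⊠ h ⊞ g ⊠ h
  ⊠-distribʳ h f g zero    = distribʳ (h 0) (f 0) (g 0)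
  ⊠-distribʳ h f g (suc n) =
    trans (+-cong (distribʳ _ (f 0) (g 0)) (⊠-distribʳ h (f ∘ suc) (g ∘ suc) n)) (interchange _ _ _ _)

  ⊠-assoc : ∀ f g h → (f ⊠ g) ⊠ h ≋ f ⊠ (g ⊠ h)
  ⊠-assoc f g h zero    = *-assoc (f 0) (g 0) (h 0)
  ⊠-assoc f g h (suc n) = begin
    (f 0 * g 0) * h (suc n) + ((f 0 · (g ∘ suc) ⊞ f ∘ suc ⊠ g) ⊠ h) n
      ≈⟨ +-cong (*-assoc _ _ _) (⊠-distribʳ h _ _ n) ⟩
    f 0 * (g 0 * h (suc n)) + ((f 0 · (g ∘ suc) ⊠ h) n + ((f ∘ suc ⊠ g) ⊠ h) n)
      ≈⟨ +-congˡ (+-cong (·-⊠ (f 0) (g ∘ suc) h n) (⊠-assoc (f ∘ suc) g h n)) ⟩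
    f 0 * (g 0 * h (suc n)) + (f 0 * (g ∘ suc ⊠ h) n + (f ∘ suc ⊠ (g ⊠ h)) n)
      ≈⟨ sym (+-assoc _ _ _) ⟩
    f 0 * (g 0 * h (suc n)) + f 0 * (g ∘ suc ⊠ h) n + (f ∘ suc ⊠ (g ⊠ h)) n
      ≈⟨ +-congʳ (sym (distribˡ (f 0) _ _)) ⟩
    f 0 * (g ⊠ h) (suc n) + (f ∘ suc ⊠ (g ⊠ h)) n ∎
    where open import Relation.Binary.Reasoning.Setoid setoid

  ⊠-sucʳ : ∀ f g n → (f ⊠ g) (suc n) ≈ f (suc n) * g 0 + (f ⊠ g ∘ suc) n
  ⊠-sucʳ f g zero    = +-comm _ _
  ⊠-sucʳ f g (suc n) = trans (+-congˡ (⊠-sucʳ (f ∘ suc) g n)) (x∙yz≈y∙xz _ _ _)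

  ⊠-comm : ∀ f g → f ⊠ g ≋ g ⊠ f
  ⊠-comm f g zero    = *-comm (f 0) (g 0)
  ⊠-comm f g (suc n) = trans (+-cong (*-comm _ _) (⊠-comm (f ∘ suc) g n)) (sym (⊠-sucʳ g f n))

  fpsRing : CommutativeRing c ℓ
  fpsRing = record
    { _≈_ = _≋_
    ; _+_ = _⊞_
    ; _*_ = _⊠_
    ; -_  = ⊟_
    ; 0#  = 𝟎
    ; 1#  = C 1#
    ; isCommutativeRing = record
      { isRing = record
        { +-isAbelianGroup = Pointwise.isAbelianGroup +-isAbelianGroup
        ; *-cong           = ⊠-cong
        ; *-assoc          = ⊠-assoc
        ; *-identity       = ⊠-identityˡ , λ f n → trans (⊠-comm f (C 1#) n) (⊠-identityˡ f n)
        ; distrib          = (λ h f g n → trans (⊠-comm h (f ⊞ g) n)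
                                (trans (⊠-distribʳ h f g n) (+-cong (⊠-comm f h n) (⊠-comm g h n))))
                           , ⊠-distribʳ
        }
      ; *-comm = ⊠-comm
      }
    }
    where import Algebra.Construct.Pointwise ℕ as Pointwise

  shift : FPS → FPS
  shift f zero    = 0#
  shift f (suc n) = f n

  shift-cong : ∀ {f g} → f ≋ g → shift f ≋ shift g
  shift-cong f≋g zero    = refl
  shift-cong f≋g (suc n) = f≋g n

  x : FPS
  x = shift (C 1#)

  x-⊠ : ∀ f → x ⊠ f ≋ shift f
  x-⊠ f zero    = zeroˡ (f 0)
  x-⊠ f (suc n) = trans (+-cong (zeroˡ _) (⊠-identityˡ f n)) (+-identityˡ (f n))

  x²-⊠ : ∀ f → x ⊠ (x ⊠ f) ≋ shift (shift f)
  x²-⊠ f n = trans (x-⊠ (x ⊠ f) n) (shift-cong (x-⊠ f) n)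

  ⊠-as-sum≤ : ∀ f g n → (f ⊠ g) n ≈ sum≤ n (λ i → f i * g (n ∸ i))
  ⊠-as-sum≤ f g zero    = refl
  ⊠-as-sum≤ f g (suc n) =
    trans (+-congˡ (⊠-as-sum≤ (f ∘ suc) g n)) (sym (sum≤-suc n (λ i → f i * g (suc n ∸ i))))

  open Sums fpsRing using () renaming ([_] to [_]ₛ; sum≤ to sum≤ₛ)
  open import Algebra.Properties.Semiring.Sum (CommutativeRing.semiring fpsRing) using ()
    renaming (sum to sumₛ)

  sumₛ-coeff : ∀ {k} (f : Fin k → FPS) n → sumₛ f n ≈ sum (λ i → f i n)
  sumₛ-coeff {zero}  f n = refl
  sumₛ-coeff {suc k} f n = +-congˡ (sumₛ-coeff (f ∘ suc) n)

  sum≤ₛ-coeff : ∀ k (f : ℕ → FPS) n → sum≤ₛ k f n ≈ sum≤ k (λ i → f i n)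
  sum≤ₛ-coeff zero    f n = refl
  sum≤ₛ-coeff (suc k) f n = +-congʳ (sum≤ₛ-coeff k f n)

  [_]ₛ-⊠ : ∀ β f → [ β ]ₛ ⊠ f ≋ [ β ] · f
  [ true  ]ₛ-⊠ f   = C-⊠ 1# f
  [ false ]ₛ-⊠ f n = trans (⊠-zeroˡ f n) (sym (zeroˡ (f n)))

module Words {c ℓ} (R : CommutativeRing c ℓ) (y : CommutativeRing.Carrier R) (k : ℕ) where
  open CommutativeRing R hiding (zero)
  open Sums R
  open TriangularSystem R using (x*z+[1-x]*z≈z)
  open import Algebra.Properties.Semiring.Sum semiring
  open import Algebra.Properties.Semiring.Mult semiring using (_×_)
  open import Algebra.Properties.Semiring.Exp semiring using (_^_)
  open import Relation.Binary.Reasoning.Setoid setoid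

  F : ℕ → Carrier
  F n = ∑ˡ (words k n) (λ w → y ^ occ213 w)

  G : Fin k → ℕ → Carrier
  G b n = ∑ˡ (words k n) (λ w → y ^ occ213 (b ∷ w))

  ∑-words-suc : ∀ n φ →
                ∑ˡ (words k (suc n)) φ ≈ ∑ˡ (words k n) (λ w → ∑[ a < k ] φ (a ∷ w))
  ∑-words-suc n φ = trans (∑ˡ-concatMap _ (words k n) φ) (∑ˡ-cong (words k n) (λ w →
    trans (∑ˡ-map (_∷ w) (allFin k) φ) (∑ˡ-tabulate id (φ ∘ (_∷ w)))))

  F-suc : ∀ n → F (suc n) ≈ ∑[ a < k ] G a n
  F-suc n = trans (∑-words-suc n (λ w → y ^ occ213 w))
                  (∑ˡ-comm-∑ (words k n) (λ w a → y ^ occ213 (a ∷ w)))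

  G₁≈F₁ : ∀ (b : Fin k) → G b 1 ≈ F 1
  G₁≈F₁ b = trans (∑-words-suc 0 (λ w → y ^ occ213 (b ∷ w)))
                  (sym (∑-words-suc 0 (λ w → y ^ occ213 w)))

  ∑acr : ℕ → (Fin k → Fin k → List (Fin k) → Carrier) → Carrier
  ∑acr n h = ∑ˡ (words k n) (λ r → ∑[ c < k ] ∑[ a < k ] h a c r)

  ∑-words-suc² : ∀ n φ → ∑ˡ (words k (suc (suc n))) φ ≈ ∑acr n (λ a c r → φ (a ∷ c ∷ r))
  ∑-words-suc² n φ = trans (∑-words-suc (suc n) φ) (∑-words-suc n _)

  ∑acr-cong : ∀ n {h h′} → (∀ a c r → h a c r ≈ h′ a c r) → ∑acr n h ≈ ∑acr n h′
  ∑acr-cong n h≈h′ =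
    ∑ˡ-cong (words k n) (λ r → sum-cong-≋ {k} (λ c → sum-cong-≋ {k} (λ a → h≈h′ a c r)))

  ∑acr-distrib-+ : ∀ n h h′ →
                   ∑acr n (λ a c r → h a c r + h′ a c r) ≈ ∑acr n h + ∑acr n h′
  ∑acr-distrib-+ n h h′ = trans (∑ˡ-cong (words k n) (λ r →
      trans (sum-cong-≋ {k} (λ c → ∑-distrib-+ (λ a → h a c r) (λ a → h′ a c r)))
            (∑-distrib-+ (λ c → ∑[ a < k ] h a c r) (λ c → ∑[ a < k ] h′ a c r))))
    (∑ˡ-distrib-+ (words k n) (λ r → ∑[ c < k ] ∑[ a < k ] h a c r)
                              (λ r → ∑[ c < k ] ∑[ a < k ] h′ a c r))

  occ213-drop : ∀ (a c : Fin k) r → ¬ c Fin.< a → occ213 (a ∷ c ∷ r) ≡ occ213 (c ∷ r)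
  occ213-drop a c []      c≮a = ≡.refl
  occ213-drop a c (d ∷ r) c≮a =
    ≡.cong (λ β → (if β ∧ does (a <? d) then 1 else 0) ℕ.+ occ213 (c ∷ d ∷ r)) (dec-false (c <? a) c≮a)

  correction : Fin k → Fin k → Fin k → List (Fin k) → Carrier
  correction b a c r = [ does (a <? b) ] * ((1# - y) * ([ does (b <? c) ] * y ^ occ213 (c ∷ r)))

  occ213-step : ∀ (b a c : Fin k) r →
    y ^ occ213 (b ∷ a ∷ c ∷ r) + correction b a c r ≈ y ^ occ213 (a ∷ c ∷ r)
  occ213-step b a c r = by-cases (a <? b) (b <? c)
    where
    by-cases : (a<b? : Dec (a Fin.< b)) (b<c? : Dec (b Fin.< c)) →
      y ^ ((if does a<b? ∧ does b<c? then 1 else 0) ℕ.+ occ213 (a ∷ c ∷ r))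
        + [ does a<b? ] * ((1# - y) * ([ does b<c? ] * y ^ occ213 (c ∷ r)))
        ≈ y ^ occ213 (a ∷ c ∷ r)
    by-cases (no _)    _         = trans (+-congˡ (zeroˡ _)) (+-identityʳ _)
    by-cases (yes _)   (no _)    =
      trans (+-congˡ (trans (*-identityˡ _) (trans (*-congˡ (zeroˡ _)) (zeroʳ _)))) (+-identityʳ _)
    by-cases (yes a<b) (yes b<c) rewrite occ213-drop a c r (Fin.<-asym (Fin.<-trans a<b b<c)) =
      trans (+-congˡ (trans (*-identityˡ _) (*-congˡ (*-identityˡ _)))) (x*z+[1-x]*z≈z y _)

  correction-sum : ∀ (b : Fin k) n →
    (toℕ b × 1#) * ((1# - y) * ∑[ c < k ] ([ does (b <? c) ] * G c n)) ≈ ∑acr n (correction b)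
  correction-sum b n = begin
    N * (q * ∑[ c < k ] (β c * G c n))
      ≈⟨ *-congˡ (*-distribˡ-sum q (λ c → β c * G c n)) ⟩
    N * ∑[ c < k ] (q * (β c * G c n))
      ≈⟨ *-congˡ (sum-cong-≋ {k} (λ c → trans (*-congˡ (*-distribˡ-∑ˡ (β c) W (φ c)))
                                              (*-distribˡ-∑ˡ q W (λ r → β c * φ c r)))) ⟩
    N * ∑[ c < k ] ∑ˡ W (λ r → q * (β c * φ c r))
      ≈⟨ *-congˡ (sym (∑ˡ-comm-∑ W (λ r c → q * (β c * φ c r)))) ⟩
    N * ∑ˡ W (λ r → ∑[ c < k ] (q * (β c * φ c r)))
      ≈⟨ *-distribˡ-∑ˡ N W (λ r → ∑[ c < k ] (q * (β c * φ c r))) ⟩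
    ∑ˡ W (λ r → N * ∑[ c < k ] (q * (β c * φ c r)))
      ≈⟨ ∑ˡ-cong W (λ r → *-distribˡ-sum N (λ c → q * (β c * φ c r))) ⟩
    ∑ˡ W (λ r → ∑[ c < k ] (N * (q * (β c * φ c r))))
      ≈⟨ ∑ˡ-cong W (λ r → sum-cong-≋ {k} (λ c → trans (*-congʳ (sym (∑[a<b]≈b b)))
           (*-distribʳ-sum {k} (q * (β c * φ c r)) (λ a → [ does (a <? b) ])))) ⟩
    ∑acr n (correction b) ∎
    where
    N = toℕ b × 1#
    q = 1# - y
    W = words k n
    β : Fin k → Carrier
    β c = [ does (b <? c) ]
    φ : Fin k → List (Fin k) → Carrier
    φ c r = y ^ occ213 (c ∷ r)

  G-recurrence : ∀ (b : Fin k) n →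
    G b (suc (suc n)) + (toℕ b × 1#) * ((1# - y) * ∑[ c < k ] ([ does (b <? c) ] * G c n))
      ≈ F (suc (suc n))
  G-recurrence b n = begin
    G b (suc (suc n)) + (toℕ b × 1#) * ((1# - y) * ∑[ c < k ] ([ does (b <? c) ] * G c n))
      ≈⟨ +-cong (∑-words-suc² n (λ w → y ^ occ213 (b ∷ w))) (correction-sum b n) ⟩
    ∑acr n (λ a c r → y ^ occ213 (b ∷ a ∷ c ∷ r)) + ∑acr n (correction b)
      ≈⟨ sym (∑acr-distrib-+ n _ _) ⟩
    ∑acr n (λ a c r → y ^ occ213 (b ∷ a ∷ c ∷ r) + correction b a c r)
      ≈⟨ ∑acr-cong n (occ213-step b) ⟩
    ∑acr n (λ a c r → y ^ occ213 (a ∷ c ∷ r))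
      ≈⟨ sym (∑-words-suc² n (λ w → y ^ occ213 w)) ⟩
    F (suc (suc n)) ∎

module WordSeries {c ℓ} (R : CommutativeRing c ℓ) (y : CommutativeRing.Carrier R) (k : ℕ) where
  open CommutativeRing R hiding (zero)
  open Sums R using ([_])
  open FormalPowerSeries R
    using (fpsRing; _≋_; _⊞_; _⊠_; C; x; shift; x-⊠; x²-⊠; C-⊠; sumₛ-coeff; [_]ₛ-⊠)
  open Sums fpsRing using () renaming ([_] to [_]ₛ)
  open import Algebra.Properties.Semiring.Sum semiring using (sum-syntax; sum-cong-≋)
  open import Algebra.Properties.Semiring.Sum (CommutativeRing.semiring fpsRing) using ()
    renaming (sum to sumₛ)
  open import Algebra.Properties.Semiring.Mult semiring using (_×_)
  open Words R y k using (F; G; F-suc; G₁≈F₁; G-recurrence)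
  open import Relation.Binary.Reasoning.Setoid setoid

  F≈1+x∑G : F ≋ C 1# ⊞ x ⊠ sumₛ G
  F≈1+x∑G zero    = +-congˡ (sym (x-⊠ (sumₛ G) zero))
  F≈1+x∑G (suc n) = begin
    F (suc n)                   ≈⟨ F-suc n ⟩
    ∑[ b < k ] G b n            ≈⟨ sym (sumₛ-coeff G n) ⟩
    sumₛ G n                    ≈⟨ sym (x-⊠ (sumₛ G) (suc n)) ⟩
    (x ⊠ sumₛ G) (suc n)        ≈⟨ sym (+-identityˡ _) ⟩
    (C 1# ⊞ x ⊠ sumₛ G) (suc n) ∎

  G-recurrenceˣ : ∀ (b : Fin k) →
    G b ⊞ x ⊠ (x ⊠ (C (toℕ b × 1#) ⊠ (C (1# - y) ⊠ sumₛ (λ c → [ does (b <? c) ]ₛ ⊠ G c))))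
      ≋ F
  G-recurrenceˣ b n = trans (+-congˡ (x²-⊠ Z n)) (by-degree n)
    where
    V = sumₛ (λ c → [ does (b <? c) ]ₛ ⊠ G c)
    Z = C (toℕ b × 1#) ⊠ (C (1# - y) ⊠ V)
    by-degree : ∀ n → G b n + shift (shift Z) n ≈ F n
    by-degree zero          = +-identityʳ (F 0)
    by-degree (suc zero)    = trans (+-identityʳ (G b 1)) (G₁≈F₁ b)
    by-degree (suc (suc n)) = trans (+-congˡ (begin
      Z n
        ≈⟨ C-⊠ _ (C (1# - y) ⊠ V) n ⟩
      (toℕ b × 1#) * (C (1# - y) ⊠ V) n
        ≈⟨ *-congˡ (C-⊠ (1# - y) V n) ⟩
      (toℕ b × 1#) * ((1# - y) * V n)
        ≈⟨ *-congˡ (*-congˡ (trans (sumₛ-coeff (λ c → [ does (b <? c) ]ₛ ⊠ G c) n)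
             (sum-cong-≋ (λ c → [ does (b <? c) ]ₛ-⊠ (G c) n)))) ⟩
      (toℕ b × 1#) * ((1# - y) * ∑[ c < k ] ([ does (b <? c) ] * G c n)) ∎))
      (G-recurrence b n)

ℤ⟦y⟧ : CommutativeRing 0ℓ 0ℓ
ℤ⟦y⟧ = FormalPowerSeries.fpsRing ℤ.+-*-commutativeRing

ℤ⟦y⟧⟦x⟧ : CommutativeRing 0ℓ 0ℓ
ℤ⟦y⟧⟦x⟧ = FormalPowerSeries.fpsRing ℤ⟦y⟧

module Py = FormalPowerSeries ℤ.+-*-commutativeRing
module Px = FormalPowerSeries ℤ⟦y⟧
module ℤy = CommutativeRing ℤ⟦y⟧

y : ℤy.Carrier
y = Py.x

module SeriesOperations where
  open CommutativeRing ℤ⟦y⟧⟦x⟧ hiding (zero)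
  open Sums ℤ⟦y⟧⟦x⟧ using (sum≤; prod≤; sum≤-cong; prod≤-cong)
  open TriangularSystem ℤ⟦y⟧⟦x⟧ using (prefixProductSum; prefixProductSum-closed)
  open Px using (x; C)
  open import Algebra.Properties.Semiring.Mult ℤy.semiring using (_×_)

  sumTo≡sum≤ : ∀ n f → sumTo n f ≡ Sums.sum≤ ℤ.+-*-commutativeRing n f
  sumTo≡sum≤ zero    f = ≡.refl
  sumTo≡sum≤ (suc n) f = ≡.cong (ℤ._+ f (suc n)) (sumTo≡sum≤ n f)

  ⊛≈* : ∀ f g → f ⊛ g ≈ f * g
  ⊛≈* f g n m = ≡.sym (begin
    (f * g) n m
      ≡⟨ Px.⊠-as-sum≤ f g n m ⟩
    sum≤ʸ n (λ i → f i ⊠ʸ g (n ∸ i)) m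
      ≡⟨ Py.sum≤ₛ-coeff n (λ i → f i ⊠ʸ g (n ∸ i)) m ⟩
    sum≤ℤ n (λ i → (f i ⊠ʸ g (n ∸ i)) m)
      ≡⟨ Sℤ.sum≤-cong n (λ i → Py.⊠-as-sum≤ (f i) (g (n ∸ i)) m) ⟩
    sum≤ℤ n (λ i → sum≤ℤ m (λ j → f i j ℤ.* g (n ∸ i) (m ∸ j)))
      ≡⟨ ≡.sym (≡.trans (sumTo≡sum≤ n _) (Sℤ.sum≤-cong n (λ i → sumTo≡sum≤ m _))) ⟩
    (f ⊛ g) n m ∎)
    where
    open ≡.≡-Reasoning
    module Sℤ = Sums ℤ.+-*-commutativeRing
    open Sℤ using () renaming (sum≤ to sum≤ℤ)
    open Sums ℤ⟦y⟧ using () renaming (sum≤ to sum≤ʸ)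
    open Py using () renaming (_⊠_ to _⊠ʸ_)

  𝟙≈1# : 𝟙 ≈ 1#
  𝟙≈1# zero    zero    = ≡.refl
  𝟙≈1# zero    (suc m) = ≡.refl
  𝟙≈1# (suc n) m       = ≡.refl

  X≈x : X ≈ x
  X≈x zero          m       = ≡.refl
  X≈x (suc zero)    zero    = ≡.refl
  X≈x (suc zero)    (suc m) = ≡.refl
  X≈x (suc (suc n)) m       = ≡.refl

  𝟙⊖Y≈C[1-y] : 𝟙 ⊖ Y ≈ C (ℤy.1# ℤy.- y)
  𝟙⊖Y≈C[1-y] zero    zero          = ≡.refl
  𝟙⊖Y≈C[1-y] zero    (suc zero)    = ≡.refl
  𝟙⊖Y≈C[1-y] zero    (suc (suc m)) = ≡.refl
  𝟙⊖Y≈C[1-y] (suc n) m             = ≡.refl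

  const≈C : ∀ j → const j ≈ C (j × ℤy.1#)
  const≈C j zero    zero    = constant-term j
    where
    constant-term : ∀ j → + j ≡ (j × ℤy.1#) 0
    constant-term zero    = ≡.refl
    constant-term (suc j) = ≡.cong (ℤ._+_ (+ 1)) (constant-term j)
  const≈C j zero    (suc m) = higher-term j
    where
    higher-term : ∀ j → + 0 ≡ (j × ℤy.1#) (suc m)
    higher-term zero    = ≡.refl
    higher-term (suc j) = ≡.cong (ℤ._+_ (+ 0)) (higher-term j)
  const≈C j (suc n) m       = ≡.refl

  sumS≈sum≤ : ∀ n s → sumS n s ≈ sum≤ n s
  sumS≈sum≤ zero    s = refl
  sumS≈sum≤ (suc n) s = +-congʳ (sumS≈sum≤ n s)

  prodS≈prod≤ : ∀ n s → prodS n s ≈ prod≤ n s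
  prodS≈prod≤ zero    s = refl
  prodS≈prod≤ (suc n) s = trans (⊛≈* (prodS n s) (s (suc n))) (*-congʳ (prodS≈prod≤ n s))

  weight : ℕ → Carrier
  weight j = const j ⊛ X ⊛ X ⊛ (𝟙 ⊖ Y)

  weight-* : ∀ j V → weight j * V ≈ x * (x * (C (j × ℤy.1#) * (C (ℤy.1# ℤy.- y) * V)))
  weight-* j V = begin
    weight j * V
      ≈⟨ *-congʳ (trans (⊛≈* _ _) (*-cong (trans (⊛≈* _ _)
           (*-cong (trans (⊛≈* _ _) (*-cong (const≈C j) X≈x)) X≈x)) 𝟙⊖Y≈C[1-y])) ⟩
    C a * x * x * C q * V
      ≈⟨ solve 4 (λ a x q V → (((a ∙ x) ∙ x) ∙ q) ∙ V ⊜ x ∙ (x ∙ (a ∙ (q ∙ V)))) refl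
           (C a) x (C q) V ⟩
    x * (x * (C a * (C q * V))) ∎
    where
    open import Relation.Binary.Reasoning.Setoid setoid
    open import Algebra.Solver.CommutativeMonoid *-commutativeMonoid
      using (solve; _⊜_) renaming (_⊕_ to _∙_)
    a = j × ℤy.1#
    q = ℤy.1# ℤy.- y

  Den≈ : ∀ k → Den (suc (suc k)) ≈ 1# - x * prefixProductSum (suc (suc k)) weight
  Den≈ k = begin
    𝟙 ⊖ X ⊖ X ⊛ sumS k (λ i → prodS i (λ j → 𝟙 ⊖ weight j))
      ≈⟨ +-cong (+-cong 𝟙≈1# (-‿cong X≈x))
                (-‿cong (trans (⊛≈* X _) (*-cong X≈x products≈))) ⟩
    1# - x - x * s
      ≈⟨ +-assoc 1# (- x) _ ⟩
    1# + (- x - x * s)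
      ≈⟨ +-congˡ {1#} (⁻¹-∙-comm x (x * s)) ⟩
    1# - (x + x * s)
      ≈⟨ +-congˡ {1#} (-‿cong (+-congʳ (sym (*-identityʳ x)))) ⟩
    1# - (x * 1# + x * s)
      ≈⟨ +-congˡ {1#} (-‿cong (sym (distribˡ x 1# s))) ⟩
    1# - x * (1# + s)
      ≈⟨ +-congˡ {1#} (-‿cong (*-congˡ (sym (prefixProductSum-closed k weight)))) ⟩
    1# - x * prefixProductSum (suc (suc k)) weight ∎
    where
    open import Relation.Binary.Reasoning.Setoid setoid
    open import Algebra.Properties.AbelianGroup +-abelianGroup using (⁻¹-∙-comm)
    s = sum≤ k (λ i → prod≤ i (λ j → 1# - weight j))
    products≈ : sumS k (λ i → prodS i (λ j → 𝟙 ⊖ weight j)) ≈ s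
    products≈ = trans (sumS≈sum≤ k _)
      (sum≤-cong k (λ i → trans (prodS≈prod≤ i _) (prod≤-cong i (λ j → +-congʳ 𝟙≈1#))))

module Coefficients where
  open import Algebra.Properties.Semiring.Exp ℤy.semiring using (_^_)

  y^-coeff : ∀ o m → (y ^ o) m ≡ (if does (o ℕ.≟ m) then + 1 else + 0)
  y^-coeff zero    zero    = ≡.refl
  y^-coeff zero    (suc m) = ≡.refl
  y^-coeff (suc o) zero    = Py.x-⊠ (y ^ o) zero
  y^-coeff (suc o) (suc m) = ≡.trans (Py.x-⊠ (y ^ o) (suc m)) (y^-coeff o m)

  length-filter-occ213 : ∀ {k} (ws : List (List (Fin k))) m →
    + length (filter (λ w → occ213 w ℕ.≟ m) ws) ≡ Sums.∑ˡ ℤ⟦y⟧ ws (λ w → y ^ occ213 w) m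
  length-filter-occ213 []       m = ≡.refl
  -- filter and y^-coeff both branch on o ≡ᵇ m, the normal form of does (o ≟ m).
  length-filter-occ213 (w ∷ ws) m rewrite y^-coeff (occ213 w) m with occ213 w ℕ.≡ᵇ m
  ... | true  = ≡.cong (ℤ._+_ (+ 1)) (length-filter-occ213 ws m)
  ... | false = ≡.trans (length-filter-occ213 ws m) (≡.sym (ℤ.+-identityˡ _))

  F213≈F : ∀ k → F213 k Px.≋ Words.F ℤ⟦y⟧ y k
  F213≈F k n = length-filter-occ213 (words k n)

theorem3p4 : (k : ℕ) → 2 ≤ k →
    (n m : ℕ) → (F213 k ⊛ Den k) n m ≡ 𝟙 n m
theorem3p4 (suc (suc k)) (s≤s (s≤s z≤n)) = begin
  F213 K ⊛ Den K                           ≈⟨ ⊛≈* (F213 K) (Den K) ⟩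
  F213 K * Den K                           ≈⟨ *-cong (F213≈F K) (Den≈ k) ⟩
  F * (1# - x * prefixProductSum K weight) ≈⟨ fixpoint⇒inverse F-fixpoint ⟩
  1#                                       ≈⟨ sym 𝟙≈1# ⟩
  𝟙                                        ∎
  where
  K = suc (suc k)
  open CommutativeRing ℤ⟦y⟧⟦x⟧ hiding (zero)
  open import Algebra.Properties.Semiring.Sum semiring using (sum-syntax)
  open import Relation.Binary.Reasoning.Setoid setoid
  open Sums ℤ⟦y⟧⟦x⟧ using ([_])
  open TriangularSystem ℤ⟦y⟧⟦x⟧ using (prefixProductSum; ∑-triangular-solution; fixpoint⇒inverse)
  open SeriesOperations using (⊛≈*; Den≈; 𝟙≈1#; weight; weight-*)
  open Coefficients using (F213≈F)
  open Words ℤ⟦y⟧ y K using (F; G)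
  open WordSeries ℤ⟦y⟧ y K using (F≈1+x∑G; G-recurrenceˣ)
  open Px using (x)

  letter-equations : ∀ b → G b + weight (toℕ b) * ∑[ c < K ] ([ does (b <? c) ] * G c) ≈ F
  letter-equations b = trans (+-congˡ {G b} (weight-* (toℕ b) _)) (G-recurrenceˣ b)

  F-fixpoint : F ≈ 1# + x * (F * prefixProductSum K weight)
  F-fixpoint =
    trans F≈1+x∑G (+-congˡ {1#} (*-congˡ {x} (∑-triangular-solution F weight G letter-equations)))
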